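{- Let $(x,y)\in S_{2n}\times S_{2n}$ and let $L$ be the orbit of $(x,y)$ under the reverted action of $B_\infty\times B_\infty$. Then there exists $(x',y')$ in the orbit of $(x,y)$ under the reverted action of $B_n\times B_n$ such that $S(x',y')\subseteq CS(x',y')=CS(x,y)$. In particular $|S(x',y')|\le|CS(x,y)|\le 2m_L$.
   Context: $S_{2n}$ is the symmetric group on $[2n]$, $B_n$ the centralizer in $S_{2n}$ of $(1\,2)(3\,4)\cdots(2n-1\,2n)$, $S_{2\infty}=\bigcup_n S_{2n}$, $B_\infty=\bigcup_nB_n$. The reverted action is $(a,b)\cdot_r(x,y)=(axb^{ -1},bya^{ -1})$. Partner map $t(2i-1)=2i$, $t(2i)=2i-1$; couples $D_i=\{2i-1,2i\}$, $\mathbb{D}=\{D_i\}$. $S(x)=\{i:x(i)\ne i\}$, $S(x,y)=S(x)\cup S(y)$, $D(x)=\{D_i\in\mathbb{D}:x(D_i)\notin\mathbb{D}\}$, $DS(x)=\bigcup_{D_i\in D(x)}D_i$, $DS(x,y)=DS(x)\cup DS(y)$, $CS(x,y)=S(xy)\cup t(S(xy))\cup DS(x,y)$. The magnitude $m_L$ of a reverted orbit $L$ is defined by $2m_L=|S(xy)|+|t(S(xy))|+|DS(x)|+|DS(y)|$ for any $(x,y)\in L$. -}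

module Defs where

open import Data.Nat using (ℕ; zero; suc; _*_; _+_)
open import Data.Nat.Properties using (+-identityʳ; +-suc)
open import Data.Fin using (Fin; zero; suc; cast; _≟_)
open import Data.Fin.Permutation using (Permutation′; _⟨$⟩ʳ_; _⟨$⟩ˡ_; _∘ₚ_; flip)
open import Data.Fin.Subset using (Subset; _∪_)
open import Data.Vec using (tabulate)
open import Data.Bool using (not)
open import Relation.Nullary using (does)
open import Relation.Binary.PropositionalEquality using (_≡_; refl; cong; trans; sym)

-- Points of [2n] are Fin (2 * n), 0-indexed: the paper's point k corresponds
-- to Fin element k-1, so couple D_i = {2i-1,2i} becomes {2(i-1), 2(i-1)+1}.

Perm : ℕ → Set
Perm m = Permutation′ m

-- product in S_{2n}: (x · y)(i) = x (y i)
_·_ : ∀ {m} → Perm m → Perm m → Perm m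
x · y = y ∘ₚ x

infixl 7 _·_

_⁻¹ : ∀ {m} → Perm m → Perm m
x ⁻¹ = flip x

dbl : ℕ → ℕ
dbl zero = zero
dbl (suc n) = suc (suc (dbl n))

dbl≡ : ∀ n → 2 * n ≡ dbl n
dbl≡ zero = refl
dbl≡ (suc n) = trans (cong suc (trans (cong (λ k → n + suc k) (+-identityʳ n)) (+-suc n n)))
                     (cong (λ k → suc (suc k)) (trans (cong (n +_) (sym (+-identityʳ n))) (dbl≡ n)))

tt : ∀ {n} → Fin (dbl n) → Fin (dbl n)
tt {suc n} zero = suc zero
tt {suc n} (suc zero) = zero
tt {suc n} (suc (suc k)) = suc (suc (tt {n} k))

-- partner map t on [2n]: swaps 2i-1 and 2i (0-indexed: 2j and 2j+1)
t : ∀ {n} → Fin (2 * n) → Fin (2 * n)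
t {n} k = cast (sym (dbl≡ n)) (tt {n} (cast (dbl≡ n) k))

-- B_n: centralizer of the involution t, i.e. a commutes with t
InB : ∀ n → Perm (2 * n) → Set
InB n a = ∀ i → a ⟨$⟩ʳ (t {n} i) ≡ t {n} (a ⟨$⟩ʳ i)

actᵣ₁ : ∀ {m} → Perm m → Perm m → Perm m → Perm m → Perm m
actᵣ₁ a b x y = a · x · (b ⁻¹)

actᵣ₂ : ∀ {m} → Perm m → Perm m → Perm m → Perm m → Perm m
actᵣ₂ a b x y = b · y · (a ⁻¹)

Supp : ∀ {n} → Perm (2 * n) → Subset (2 * n)
Supp {n} x = tabulate λ i → not (does (x ⟨$⟩ʳ i ≟ i))

Supp₂ : ∀ {n} → Perm (2 * n) → Perm (2 * n) → Subset (2 * n)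
Supp₂ {n} x y = Supp {n} x ∪ Supp {n} y

-- t(A) = {t i : i ∈ A}; since t is an involution, i ∈ t(A) iff t i ∈ A
tImg : ∀ {n} → Subset (2 * n) → Subset (2 * n)
tImg {n} A = tabulate λ i → Data.Vec.lookup A (t {n} i)

-- DS(x) = union of couples D with x(D) ∉ 𝔻.  For the couple D = {i, t i},
-- x(D) = {x i, x (t i)} is a couple iff x (t i) = t (x i).
DS : ∀ {n} → Perm (2 * n) → Subset (2 * n)
DS {n} x = tabulate λ i → not (does (x ⟨$⟩ʳ (t {n} i) ≟ t {n} (x ⟨$⟩ʳ i)))

DS₂ : ∀ {n} → Perm (2 * n) → Perm (2 * n) → Subset (2 * n)
DS₂ {n} x y = DS {n} x ∪ DS {n} y

CS : ∀ {n} → Perm (2 * n) → Perm (2 * n) → Subset (2 * n)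
CS {n} x y = (Supp {n} (x · y) ∪ tImg {n} (Supp {n} (x · y))) ∪ DS₂ {n} x y

-- 2 m_L computed from the representative (x,y) of L
twoM : ∀ {n} → Perm (2 * n) → Perm (2 * n) → ℕ
twoM {n} x y = Data.Fin.Subset.∣ Supp {n} (x · y) ∣ + Data.Fin.Subset.∣ tImg {n} (Supp {n} (x · y)) ∣
           + Data.Fin.Subset.∣ DS {n} x ∣ + Data.Fin.Subset.∣ DS {n} y ∣

module Submission where

-- We act by (1 , π⁻¹) with π ∈ B_n, so x' = x π and y' = π⁻¹ y.  Then x' y' = x y
-- and DS(y') = DS(y), while i ∈ DS(x') iff π i ∈ DS(x).  Call i free when it lies
-- outside the core S(xy) ∪ t(S(xy)) ∪ DS(y).  On free points the partial map
--   f i = i  if i ∈ DS(x),     f i = y i  otherwise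
-- is injective and commutes with t, so (extension lemma) it is the restriction of
-- some π ∈ B_n.  For this π membership in DS(x') agrees with membership in DS(x)
-- on free points, hence CS(x' , y') = CS(x , y); and a point outside CS(x , y) is
-- free with y i = π i, so it is fixed by both x' = x π and y' = π⁻¹ y.

open import Defs
open import Data.Nat using (ℕ; suc; _*_; _+_; _≤_; z≤n; s≤s)
open import Data.Nat.Properties using (+-suc; m≤n⇒m≤1+n; +-assoc; +-mono-≤; ≤-trans)
open import Data.Fin using (Fin; zero; suc; cast; _≟_)
open import Data.Fin.Properties using (cast-involutive)
open import Data.Fin.Permutation using (_⟨$⟩ʳ_; _⟨$⟩ˡ_; _∘ₚ_; flip; permutation; inverseˡ; inverseʳ; id)
open import Data.Fin.Subset using (Subset; _∪_; _⊆_; ∣_∣)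
open import Data.Fin.Subset.Properties using (p⊆q⇒∣p∣≤∣q∣; ∪-assoc; ∪-comm)
open import Data.Bool using (Bool; true; false; not; _xor_; _∨_; if_then_else_)
open import Data.Bool.Properties using (xor-assoc; xor-same; xor-identityʳ; not-distribˡ-xor; ∨-conicalˡ; ∨-conicalʳ; ∨-comm) renaming (_≟_ to _≟ᵇ_)
open import Data.Product using (Σ; _×_; _,_; proj₁; proj₂; map₁)
open import Data.Sum using (_⊎_; inj₁; inj₂)
import Data.Sum as Sum
open import Data.Vec using ([]; _∷_; lookup; tabulate)
open import Data.Vec.Properties using (lookup∘tabulate; tabulate-cong; lookup-zipWith; []=⇒lookup; lookup⇒[]=)
open import Data.List using (List; []; _∷_; allFin)
open import Data.List.Membership.Propositional using (_∈_)
open import Data.List.Membership.Propositional.Properties using (∈-allFin)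
open import Data.List.Relation.Unary.Any using (here; there)
open import Relation.Nullary using (Dec; yes; no; does; contradiction)
open import Relation.Unary using (Decidable)
open import Relation.Binary.PropositionalEquality using (_≡_; _≢_; refl; cong; cong₂; trans; sym; subst; module ≡-Reasoning)

-- Couple coordinates.  The point 2j + b of [2n] (b ∈ {0,1}) has coordinates
-- (j , b); the partner map t flips the side b and keeps the couple j.

flipSide : ∀ {n} → Fin n × Bool → Fin n × Bool
flipSide (c , b) = c , not b

coord′ : ∀ {n} → Fin (dbl n) → Fin n × Bool
coord′ {suc n} zero = zero , false
coord′ {suc n} (suc zero) = zero , true
coord′ {suc n} (suc (suc k)) = map₁ suc (coord′ k)

point′ : ∀ {n} → Fin n × Bool → Fin (dbl n)
point′ {suc n} (zero , false) = zero
point′ {suc n} (zero , true) = suc zero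
point′ {suc n} (suc c , b) = suc (suc (point′ (c , b)))

point′-coord′ : ∀ {n} (k : Fin (dbl n)) → point′ (coord′ k) ≡ k
point′-coord′ {suc n} zero = refl
point′-coord′ {suc n} (suc zero) = refl
point′-coord′ {suc n} (suc (suc k)) = cong (λ z → suc (suc z)) (point′-coord′ k)

coord′-point′ : ∀ {n} (p : Fin n × Bool) → coord′ (point′ p) ≡ p
coord′-point′ {suc n} (zero , false) = refl
coord′-point′ {suc n} (zero , true) = refl
coord′-point′ {suc n} (suc c , b) = cong (map₁ suc) (coord′-point′ (c , b))

coord′-tt : ∀ {n} (k : Fin (dbl n)) → coord′ (tt k) ≡ flipSide (coord′ k)
coord′-tt {suc n} zero = refl
coord′-tt {suc n} (suc zero) = refl
coord′-tt {suc n} (suc (suc k)) = cong (map₁ suc) (coord′-tt k)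

coord : ∀ {n} → Fin (2 * n) → Fin n × Bool
coord {n} i = coord′ (cast (dbl≡ n) i)

point : ∀ {n} → Fin n × Bool → Fin (2 * n)
point {n} p = cast (sym (dbl≡ n)) (point′ p)

point-coord : ∀ {n} (i : Fin (2 * n)) → point {n} (coord {n} i) ≡ i
point-coord {n} i = trans (cong (cast (sym (dbl≡ n))) (point′-coord′ (cast (dbl≡ n) i)))
                          (cast-involutive (sym (dbl≡ n)) (dbl≡ n) i)

coord-point : ∀ {n} (p : Fin n × Bool) → coord {n} (point p) ≡ p
coord-point {n} p = trans (cong coord′ (cast-involutive (dbl≡ n) (sym (dbl≡ n)) (point′ p)))
                          (coord′-point′ p)

coord-t : ∀ {n} (i : Fin (2 * n)) → coord {n} (t {n} i) ≡ flipSide (coord {n} i)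
coord-t {n} i = trans (cong coord′ (cast-involutive (dbl≡ n) (sym (dbl≡ n)) (tt (cast (dbl≡ n) i))))
                      (coord′-tt (cast (dbl≡ n) i))

coord-injective : ∀ {n} {i j : Fin (2 * n)} → coord {n} i ≡ coord {n} j → i ≡ j
coord-injective {n} {i} {j} e = trans (sym (point-coord {n} i)) (trans (cong (point {n}) e) (point-coord {n} j))

t-involutive : ∀ {n} (i : Fin (2 * n)) → t {n} (t {n} i) ≡ i
t-involutive {n} i = coord-injective {n} (begin
  coord {n} (t {n} (t {n} i))       ≡⟨ coord-t {n} (t {n} i) ⟩
  flipSide (coord {n} (t {n} i))     ≡⟨ cong flipSide (coord-t {n} i) ⟩
  flipSide (flipSide (coord {n} i)) ≡⟨ flipSide-involutive (coord {n} i) ⟩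
  coord {n} i                        ∎)
  where
  open ≡-Reasoning
  flipSide-involutive : (p : Fin n × Bool) → flipSide (flipSide p) ≡ p
  flipSide-involutive (c , false) = refl
  flipSide-involutive (c , true) = refl

t-point : ∀ {n} (p : Fin n × Bool) → t {n} (point p) ≡ point (flipSide p)
t-point {n} p = coord-injective {n} (trans (coord-t {n} (point p))
                              (trans (cong flipSide (coord-point p)) (sym (coord-point (flipSide p)))))

couple : ∀ {n} → Fin (2 * n) → Fin n
couple {n} i = proj₁ (coord {n} i)

same-couple : ∀ {n} (i j : Fin (2 * n)) → couple {n} i ≡ couple {n} j → i ≡ j ⊎ i ≡ t {n} j
same-couple {n} i j e =
  Sum.map (coord-injective {n}) (λ h → coord-injective {n} (trans h (sym (coord-t {n} j)))) (sides (coord {n} i) (coord {n} j) e)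
  where
  sides : ∀ {n} (p q : Fin n × Bool) → proj₁ p ≡ proj₁ q → p ≡ q ⊎ p ≡ flipSide q
  sides (c , false) (.c , false) refl = inj₁ refl
  sides (c , false) (.c , true) refl = inj₂ refl
  sides (c , true) (.c , false) refl = inj₂ refl
  sides (c , true) (.c , true) refl = inj₁ refl

∘-B : ∀ {n} {a b : Perm (2 * n)} → InB n a → InB n b → InB n (a ∘ₚ b)
∘-B {b = b} aB bB i = trans (cong (b ⟨$⟩ʳ_) (aB i)) (bB _)

perm-injective : ∀ {m} (π : Perm m) {i j} → π ⟨$⟩ʳ i ≡ π ⟨$⟩ʳ j → i ≡ j
perm-injective π {i} {j} e = trans (sym (inverseˡ π)) (trans (cong (π ⟨$⟩ˡ_) e) (inverseˡ π))

inverse-B : ∀ {n} {π : Perm (2 * n)} → InB n π → InB n (flip π)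
inverse-B {n} {π} πB i =
  perm-injective π (trans (inverseʳ π) (sym (trans (πB (π ⟨$⟩ˡ i)) (cong (t {n}) (inverseʳ π)))))

module CoupleExchange {n : ℕ} (cu cv : Fin n) (δ : Bool) where

  ρ : Fin n × Bool → Fin n × Bool
  ρ (c , β) with c ≟ cu | c ≟ cv
  ... | yes _ | _ = cv , β xor δ
  ... | no _ | yes _ = cu , β xor δ
  ... | no _ | no _ = c , β

  ρ-fixes : ∀ c β → c ≢ cu → c ≢ cv → ρ (c , β) ≡ (c , β)
  ρ-fixes c β c≢cu c≢cv with c ≟ cu | c ≟ cv
  ... | yes e | _ = contradiction e c≢cu
  ... | no _ | yes e = contradiction e c≢cv
  ... | no _ | no _ = refl

  ρ-cu : ∀ β → ρ (cu , β) ≡ (cv , β xor δ)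
  ρ-cu β with cu ≟ cu
  ... | yes _ = refl
  ... | no cu≢cu = contradiction refl cu≢cu

  ρ-cv : ∀ β → cv ≢ cu → ρ (cv , β) ≡ (cu , β xor δ)
  ρ-cv β cv≢cu with cv ≟ cu | cv ≟ cv
  ... | yes e | _ = contradiction e cv≢cu
  ... | no _ | yes _ = refl
  ... | no _ | no cv≢cv = contradiction refl cv≢cv

  untwist : ∀ β → (β xor δ) xor δ ≡ β
  untwist β = trans (xor-assoc β δ δ) (trans (cong (β xor_) (xor-same δ)) (xor-identityʳ β))

  ρ-back : ∀ β → ρ (cv , β xor δ) ≡ (cu , β)
  ρ-back β = by-cases (cv ≟ cu)
    where
    by-cases : Dec (cv ≡ cu) → ρ (cv , β xor δ) ≡ (cu , β)
    by-cases (yes cv≡cu) = trans (cong (λ c → ρ (c , β xor δ)) cv≡cu)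
                                 (trans (ρ-cu (β xor δ)) (cong₂ _,_ cv≡cu (untwist β)))
    by-cases (no cv≢cu) = trans (ρ-cv (β xor δ) cv≢cu) (cong (cu ,_) (untwist β))

  ρ-involutive : ∀ p → ρ (ρ p) ≡ p
  ρ-involutive (c , β) with c ≟ cu | c ≟ cv
  ... | yes refl | _ = ρ-back β
  ... | no _ | yes refl = trans (ρ-cu (β xor δ)) (cong (c ,_) (untwist β))
  ... | no c≢cu | no c≢cv = ρ-fixes c β c≢cu c≢cv

  ρ-flipSide : ∀ p → ρ (flipSide p) ≡ flipSide (ρ p)
  ρ-flipSide (c , β) with c ≟ cu | c ≟ cv
  ... | yes _ | _ = cong (cv ,_) (sym (not-distribˡ-xor β δ))
  ... | no _ | yes _ = cong (cu ,_) (sym (not-distribˡ-xor β δ))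
  ... | no _ | no _ = refl

module CoupleTransposition {n : ℕ} (u v : Fin (2 * n)) where

  side : Fin (2 * n) → Bool
  side i = proj₂ (coord {n} i)

  -- the side twist making u land on v
  twist : Bool
  twist = side u xor side v

  open CoupleExchange (couple {n} u) (couple {n} v) twist

  τ⟨_⟩ : Fin (2 * n) → Fin (2 * n)
  τ⟨ i ⟩ = point {n} (ρ (coord {n} i))

  τ-involutive : ∀ i → τ⟨ τ⟨ i ⟩ ⟩ ≡ i
  τ-involutive i = trans (cong (λ p → point {n} (ρ p)) (coord-point {n} (ρ (coord {n} i))))
                         (trans (cong point (ρ-involutive (coord {n} i))) (point-coord {n} i))

  τ : Perm (2 * n)
  τ = permutation τ⟨_⟩ τ⟨_⟩ τ-involutive τ-involutive

  τ-B : InB n τ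
  τ-B i = trans (cong (λ p → point {n} (ρ p)) (coord-t {n} i))
                (trans (cong point (ρ-flipSide (coord {n} i))) (sym (t-point {n} (ρ (coord {n} i)))))

  τ-u : τ⟨ u ⟩ ≡ v
  τ-u = begin
    point {n} (ρ (couple {n} u , side u))          ≡⟨ cong point (ρ-cu (side u)) ⟩
    point {n} (couple {n} v , side u xor twist)    ≡⟨ cong (λ b → point {n} (couple {n} v , b)) (cancel (side u) (side v)) ⟩
    point {n} (coord {n} v)                        ≡⟨ point-coord {n} v ⟩
    v                                              ∎
    where
    open ≡-Reasoning
    cancel : ∀ a b → a xor (a xor b) ≡ b
    cancel a b = trans (sym (xor-assoc a a b)) (cong (_xor b) (xor-same a))

  τ-fixes : ∀ i → couple {n} i ≢ couple {n} u → couple {n} i ≢ couple {n} v → τ⟨ i ⟩ ≡ i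
  τ-fixes i ≢u ≢v = trans (cong point (ρ-fixes (couple {n} i) (side i) ≢u ≢v)) (point-coord {n} i)

module Extension {n : ℕ} (Dom : Fin (2 * n) → Set) (Dom? : Decidable Dom)
  (f : Fin (2 * n) → Fin (2 * n))
  (Dom-t : ∀ {i} → Dom i → Dom (t {n} i))
  (f-t : ∀ {i} → Dom i → f (t {n} i) ≡ t {n} (f i))
  (f-injective : ∀ {i j} → Dom i → Dom j → f i ≡ f j → i ≡ j) where

  AgreesOn : List (Fin (2 * n)) → Perm (2 * n) → Set
  AgreesOn L π = InB n π × (∀ {i} → i ∈ L → Dom i → π ⟨$⟩ʳ i ≡ f i)

  corrected : Perm (2 * n) → Fin (2 * n) → Perm (2 * n)
  corrected π p = π ∘ₚ CoupleTransposition.τ {n} (π ⟨$⟩ʳ p) (f p)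

  -- Correcting π at a new point p of Dom makes it agree with f at p and t p, and
  -- keeps the old agreements: those points lie outside both exchanged couples.
  extend-at : ∀ {p L} {π : Perm (2 * n)} → Dom p → AgreesOn L π → AgreesOn (p ∷ L) (corrected π p)
  extend-at {p} {L} {π} Dp (πB , agree) = ∘-B {n} {π} {τ} πB τ-B , agrees
    where
    open CoupleTransposition {n} (π ⟨$⟩ʳ p) (f p)

    at-tp : τ⟨ π ⟨$⟩ʳ t {n} p ⟩ ≡ f (t {n} p)
    at-tp = trans (cong τ⟨_⟩ (πB p)) (trans (τ-B _) (trans (cong (t {n}) τ-u) (sym (f-t Dp))))

    away : ∀ {i} → i ∈ L → Dom i → i ≢ p → i ≢ t {n} p → τ⟨ π ⟨$⟩ʳ i ⟩ ≡ f i
    away {i} iL Di i≢p i≢tp = trans (cong τ⟨_⟩ πi≡fi) (τ-fixes (f i) apart-from-πp apart-from-fp)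
      where
      πi≡fi : π ⟨$⟩ʳ i ≡ f i
      πi≡fi = agree iL Di
      apart-from-πp : couple {n} (f i) ≢ couple {n} (π ⟨$⟩ʳ p)
      apart-from-πp e with same-couple {n} (f i) (π ⟨$⟩ʳ p) e
      ... | inj₁ q = i≢p (perm-injective π (trans πi≡fi q))
      ... | inj₂ q = i≢tp (perm-injective π (trans πi≡fi (trans q (sym (πB p)))))
      apart-from-fp : couple {n} (f i) ≢ couple {n} (f p)
      apart-from-fp e with same-couple {n} (f i) (f p) e
      ... | inj₁ q = i≢p (f-injective Di Dp q)
      ... | inj₂ q = i≢tp (f-injective Di (Dom-t Dp) (trans q (sym (f-t Dp))))

    agrees : ∀ {i} → i ∈ p ∷ L → Dom i → τ⟨ π ⟨$⟩ʳ i ⟩ ≡ f i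
    agrees (here refl) Di = τ-u
    agrees {i} (there iL) Di with i ≟ p | i ≟ t {n} p
    ... | yes refl | _ = τ-u
    ... | no _ | yes refl = at-tp
    ... | no i≢p | no i≢tp = away iL Di i≢p i≢tp

  extendOn : ∀ L → Σ (Perm (2 * n)) (AgreesOn L)
  extendOn [] = id , (λ _ → refl) , (λ ())
  extendOn (p ∷ L) with extendOn L | Dom? p
  ... | π , agreement | yes Dp = corrected π p , extend-at {p} {L} {π} Dp agreement
  ... | π , (πB , agree) | no ¬Dp = π , πB , agrees
    where
    agrees : ∀ {i} → i ∈ p ∷ L → Dom i → π ⟨$⟩ʳ i ≡ f i
    agrees (here refl) Di = contradiction Di ¬Dp
    agrees (there iL) Di = agree iL Di

  extension : Σ (Perm (2 * n)) λ π → InB n π × (∀ {i} → Dom i → π ⟨$⟩ʳ i ≡ f i)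
  extension with extendOn (allFin (2 * n))
  ... | π , πB , agree = π , πB , λ Di → agree (∈-allFin _) Di

neq : ∀ {m} → Fin m → Fin m → Bool
neq a b = not (does (a ≟ b))

neq-false : ∀ {m} {a b : Fin m} → neq a b ≡ false → a ≡ b
neq-false {a = a} {b} e with a ≟ b
... | yes a≡b = a≡b

≡⇒neq-false : ∀ {m} {a b : Fin m} → a ≡ b → neq a b ≡ false
≡⇒neq-false {a = a} {b} a≡b with a ≟ b
... | yes _ = refl
... | no a≢b = contradiction a≡b a≢b

neq-perm : ∀ {m} (ρ : Perm m) (a b : Fin m) → neq (ρ ⟨$⟩ʳ a) (ρ ⟨$⟩ʳ b) ≡ neq a b
neq-perm ρ a b with a ≟ b | (ρ ⟨$⟩ʳ a) ≟ (ρ ⟨$⟩ʳ b)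
... | yes _ | yes _ = refl
... | no _ | no _ = refl
... | yes a≡b | no ρa≢ρb = contradiction (cong (ρ ⟨$⟩ʳ_) a≡b) ρa≢ρb
... | no a≢b | yes ρa≡ρb = contradiction (perm-injective ρ ρa≡ρb) a≢b

neq-t : ∀ {n} (a b : Fin (2 * n)) → neq a (t {n} b) ≡ neq b (t {n} a)
neq-t {n} a b with a ≟ t {n} b | b ≟ t {n} a
... | yes _ | yes _ = refl
... | no _ | no _ = refl
... | yes a≡tb | no b≢ta = contradiction (trans (sym (t-involutive {n} b)) (cong (t {n}) (sym a≡tb))) b≢ta
... | no a≢tb | yes b≡ta = contradiction (trans (sym (t-involutive {n} a)) (cong (t {n}) (sym b≡ta))) a≢tb

moved : ∀ {m} → Perm m → Fin m → Bool
moved z i = neq (z ⟨$⟩ʳ i) i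

broken : ∀ {n} → Perm (2 * n) → Fin (2 * n) → Bool
broken {n} z i = neq (z ⟨$⟩ʳ t {n} i) (t {n} (z ⟨$⟩ʳ i))

broken-t : ∀ {n} (z : Perm (2 * n)) i → broken {n} z (t {n} i) ≡ broken {n} z i
broken-t {n} z i = trans (cong (λ w → neq (z ⟨$⟩ʳ w) (t {n} (z ⟨$⟩ʳ t {n} i))) (t-involutive {n} i))
                         (neq-t {n} (z ⟨$⟩ʳ i) (z ⟨$⟩ʳ t {n} i))

lookup-Supp : ∀ {n} (z : Perm (2 * n)) i → lookup (Supp {n} z) i ≡ moved z i
lookup-Supp z i = lookup∘tabulate (moved z) i

lookup-DS : ∀ {n} (z : Perm (2 * n)) i → lookup (DS {n} z) i ≡ broken {n} z i
lookup-DS {n} z i = lookup∘tabulate (broken {n} z) i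

lookup-tImg : ∀ {n} (A : Subset (2 * n)) i → lookup (tImg {n} A) i ≡ lookup A (t {n} i)
lookup-tImg {n} A i = lookup∘tabulate (λ j → lookup A (t {n} j)) i

lookup-∪ : ∀ {m} (p q : Subset m) i → lookup (p ∪ q) i ≡ lookup p i ∨ lookup q i
lookup-∪ p q i = lookup-zipWith _∨_ i p q

⊆-by-lookup : ∀ {m} {p q : Subset m} → (∀ i → lookup q i ≡ false → lookup p i ≡ false) → p ⊆ q
⊆-by-lookup {p = p} {q} h {i} i∈p with lookup q i in e
... | true = lookup⇒[]= i q e
... | false with trans (sym ([]=⇒lookup i∈p)) (h i e)
...   | ()

∪-cong-outside : ∀ {m} (r p q : Subset m) → (∀ i → lookup r i ≡ false → lookup p i ≡ lookup q i) →
                 r ∪ p ≡ r ∪ q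
∪-cong-outside [] [] [] h = refl
∪-cong-outside (true ∷ r) (_ ∷ p) (_ ∷ q) h = cong (true ∷_) (∪-cong-outside r p q (λ i → h (suc i)))
∪-cong-outside (false ∷ r) (_ ∷ p) (_ ∷ q) h = cong₂ _∷_ (h zero refl) (∪-cong-outside r p q (λ i → h (suc i)))

∣p∪q∣≤∣p∣+∣q∣ : ∀ {m} (p q : Subset m) → ∣ p ∪ q ∣ ≤ ∣ p ∣ + ∣ q ∣
∣p∪q∣≤∣p∣+∣q∣ [] [] = z≤n
∣p∪q∣≤∣p∣+∣q∣ (false ∷ p) (false ∷ q) = ∣p∪q∣≤∣p∣+∣q∣ p q
∣p∪q∣≤∣p∣+∣q∣ (false ∷ p) (true ∷ q) = subst (suc ∣ p ∪ q ∣ ≤_) (sym (+-suc ∣ p ∣ ∣ q ∣)) (s≤s (∣p∪q∣≤∣p∣+∣q∣ p q))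
∣p∪q∣≤∣p∣+∣q∣ (true ∷ p) (false ∷ q) = s≤s (∣p∪q∣≤∣p∣+∣q∣ p q)
∣p∪q∣≤∣p∣+∣q∣ (true ∷ p) (true ∷ q) =
  s≤s (subst (∣ p ∪ q ∣ ≤_) (sym (+-suc ∣ p ∣ ∣ q ∣)) (m≤n⇒m≤1+n (∣p∪q∣≤∣p∣+∣q∣ p q)))

∣CS∣≤twoM : ∀ {n} (x y : Perm (2 * n)) → ∣ CS {n} x y ∣ ≤ twoM {n} x y
∣CS∣≤twoM {n} x y =
  subst (∣ CS {n} x y ∣ ≤_) (sym (+-assoc (∣ S ∣ + ∣ tImg {n} S ∣) ∣ DS {n} x ∣ ∣ DS {n} y ∣))
    (≤-trans (∣p∪q∣≤∣p∣+∣q∣ (S ∪ tImg {n} S) (DS₂ {n} x y))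
             (+-mono-≤ (∣p∪q∣≤∣p∣+∣q∣ S (tImg {n} S)) (∣p∪q∣≤∣p∣+∣q∣ (DS {n} x) (DS {n} y))))
  where
  S : Subset (2 * n)
  S = Supp {n} (x · y)

module ActByInverse {n : ℕ} (x y π : Perm (2 * n)) (πB : InB n π) where

  x' y' : Perm (2 * n)
  x' = actᵣ₁ id (flip π) x y
  y' = actᵣ₂ id (flip π) x y

  product-preserved : Supp {n} (x' · y') ≡ Supp {n} (x · y)
  product-preserved = tabulate-cong λ i → cong (λ j → neq (x ⟨$⟩ʳ j) i) (inverseʳ π)

  DS-y-preserved : DS {n} y' ≡ DS {n} y
  DS-y-preserved = tabulate-cong λ i →
    trans (cong (neq (π ⟨$⟩ˡ (y ⟨$⟩ʳ t {n} i))) (sym (inverse-B {n} {π} πB (y ⟨$⟩ʳ i))))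
          (neq-perm (flip π) (y ⟨$⟩ʳ t {n} i) (t {n} (y ⟨$⟩ʳ i)))

  broken-x' : ∀ i → broken {n} x' i ≡ broken {n} x (π ⟨$⟩ʳ i)
  broken-x' i = cong (λ j → neq (x ⟨$⟩ʳ j) (t {n} (x ⟨$⟩ʳ (π ⟨$⟩ʳ i)))) (πB i)

-- CS(x , y) = core ∪ DS(x), where the core S(xy) ∪ t(S(xy)) ∪ DS(y) does not involve
-- x separately.
core : ∀ {n} → Perm (2 * n) → Perm (2 * n) → Subset (2 * n)
core {n} x y = (Supp {n} (x · y) ∪ tImg {n} (Supp {n} (x · y))) ∪ DS {n} y

CS≡core∪DS : ∀ {n} (x y : Perm (2 * n)) → CS {n} x y ≡ core {n} x y ∪ DS {n} x
CS≡core∪DS {n} x y =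
  trans (cong (Sxy ∪_) (∪-comm (DS {n} x) (DS {n} y))) (sym (∪-assoc Sxy (DS {n} y) (DS {n} x)))
  where
  Sxy : Subset (2 * n)
  Sxy = Supp {n} (x · y) ∪ tImg {n} (Supp {n} (x · y))

module Construction {n : ℕ} (x y : Perm (2 * n)) where

  xy : Perm (2 * n)
  xy = x · y

  Free : Fin (2 * n) → Set
  Free i = lookup (core {n} x y) i ≡ false

  lookup-core : ∀ i → lookup (core {n} x y) i ≡ (moved xy i ∨ moved xy (t {n} i)) ∨ broken {n} y i
  lookup-core i = trans (lookup-∪ (S ∪ tImg {n} S) (DS {n} y) i)
    (cong₂ _∨_ (trans (lookup-∪ S (tImg {n} S) i)
                      (cong₂ _∨_ (lookup-Supp {n} xy i) (trans (lookup-tImg {n} S i) (lookup-Supp {n} xy (t {n} i)))))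
               (lookup-DS {n} y i))
    where
    S : Subset (2 * n)
    S = Supp {n} xy

  free-parts : ∀ {i} → Free i →
               (moved xy i ≡ false × moved xy (t {n} i) ≡ false) × broken {n} y i ≡ false
  free-parts {i} h = (∨-conicalˡ A B AB , ∨-conicalʳ A B AB) , ∨-conicalʳ (A ∨ B) C ABC
    where
    A B C : Bool
    A = moved xy i
    B = moved xy (t {n} i)
    C = broken {n} y i
    ABC : (A ∨ B) ∨ C ≡ false
    ABC = trans (sym (lookup-core i)) h
    AB : A ∨ B ≡ false
    AB = ∨-conicalˡ (A ∨ B) C ABC

  xy-fixes : ∀ {i} → Free i → x ⟨$⟩ʳ (y ⟨$⟩ʳ i) ≡ i
  xy-fixes h = neq-false (proj₁ (proj₁ (free-parts h)))

  xy-fixes-t : ∀ {i} → Free i → x ⟨$⟩ʳ (y ⟨$⟩ʳ t {n} i) ≡ t {n} i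
  xy-fixes-t h = neq-false (proj₂ (proj₁ (free-parts h)))

  y-t : ∀ {i} → Free i → y ⟨$⟩ʳ t {n} i ≡ t {n} (y ⟨$⟩ʳ i)
  y-t h = neq-false (proj₂ (free-parts h))

  Free-t : ∀ {i} → Free i → Free (t {n} i)
  Free-t {i} h = begin
    lookup (core {n} x y) (t {n} i)                               ≡⟨ lookup-core (t {n} i) ⟩
    (moved xy (t {n} i) ∨ moved xy (t {n} (t {n} i))) ∨ broken {n} y (t {n} i)
        ≡⟨ cong₂ (λ a b → (moved xy (t {n} i) ∨ a) ∨ b) (cong (moved xy) (t-involutive {n} i)) (broken-t {n} y i) ⟩
    (moved xy (t {n} i) ∨ moved xy i) ∨ broken {n} y i            ≡⟨ cong (_∨ broken {n} y i) (∨-comm (moved xy (t {n} i)) (moved xy i)) ⟩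
    (moved xy i ∨ moved xy (t {n} i)) ∨ broken {n} y i            ≡⟨ sym (lookup-core i) ⟩
    lookup (core {n} x y) i                                        ≡⟨ h ⟩
    false                                                          ∎
    where open ≡-Reasoning

  broken-x-at-y : ∀ {i} → Free i → broken {n} x (y ⟨$⟩ʳ i) ≡ false
  broken-x-at-y {i} h = ≡⇒neq-false (begin
    x ⟨$⟩ʳ t {n} (y ⟨$⟩ʳ i)   ≡⟨ cong (x ⟨$⟩ʳ_) (sym (y-t h)) ⟩
    x ⟨$⟩ʳ (y ⟨$⟩ʳ t {n} i)   ≡⟨ xy-fixes-t h ⟩
    t {n} i                  ≡⟨ cong (t {n}) (sym (xy-fixes h)) ⟩
    t {n} (x ⟨$⟩ʳ (y ⟨$⟩ʳ i)) ∎)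
    where open ≡-Reasoning

  f : Fin (2 * n) → Fin (2 * n)
  f i = if broken {n} x i then i else y ⟨$⟩ʳ i

  broken-or-intact : (i : Fin (2 * n)) → broken {n} x i ≡ true ⊎ broken {n} x i ≡ false
  broken-or-intact i with broken {n} x i
  ... | true = inj₁ refl
  ... | false = inj₂ refl

  f-broken : ∀ {i} → broken {n} x i ≡ true → f i ≡ i
  f-broken {i} e = cong (λ b → if b then i else y ⟨$⟩ʳ i) e

  f-intact : ∀ {i} → broken {n} x i ≡ false → f i ≡ y ⟨$⟩ʳ i
  f-intact {i} e = cong (λ b → if b then i else y ⟨$⟩ʳ i) e

  f-t : ∀ {i} → Free i → f (t {n} i) ≡ t {n} (f i)
  f-t {i} h with broken-or-intact i
  ... | inj₁ e = trans (f-broken (trans (broken-t {n} x i) e)) (cong (t {n}) (sym (f-broken e)))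
  ... | inj₂ e = trans (f-intact (trans (broken-t {n} x i) e)) (trans (y-t h) (cong (t {n}) (sym (f-intact e))))

  broken≢y-free : ∀ {i j} → Free j → broken {n} x i ≡ true → i ≢ y ⟨$⟩ʳ j
  broken≢y-free {i} hj e refl with trans (sym e) (broken-x-at-y hj)
  ... | ()

  f-injective : ∀ {i j} → Free i → Free j → f i ≡ f j → i ≡ j
  f-injective {i} {j} hi hj fi≡fj with broken-or-intact i | broken-or-intact j
  ... | inj₁ ei | inj₁ ej = trans (sym (f-broken ei)) (trans fi≡fj (f-broken ej))
  ... | inj₂ ei | inj₂ ej = perm-injective y (trans (sym (f-intact ei)) (trans fi≡fj (f-intact ej)))
  ... | inj₁ ei | inj₂ ej =
    contradiction (trans (sym (f-broken ei)) (trans fi≡fj (f-intact ej))) (broken≢y-free hj ei)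
  ... | inj₂ ei | inj₁ ej =
    contradiction (trans (sym (f-broken ej)) (trans (sym fi≡fj) (f-intact ei))) (broken≢y-free hi ej)

  Free? : Decidable Free
  Free? i = lookup (core {n} x y) i ≟ᵇ false

  open Extension {n} Free Free? f Free-t f-t f-injective using (extension)

  π : Perm (2 * n)
  π = proj₁ extension

  π-B : InB n π
  π-B = proj₁ (proj₂ extension)

  π-agrees : ∀ {i} → Free i → π ⟨$⟩ʳ i ≡ f i
  π-agrees = proj₂ (proj₂ extension)

  broken-x-π : ∀ {i} → Free i → broken {n} x (π ⟨$⟩ʳ i) ≡ broken {n} x i
  broken-x-π {i} h with broken-or-intact i
  ... | inj₁ e = cong (broken {n} x) (trans (π-agrees h) (f-broken e))
  ... | inj₂ e = trans (cong (broken {n} x) (trans (π-agrees h) (f-intact e))) (trans (broken-x-at-y h) (sym e))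

  open ActByInverse {n} x y π π-B public

  core-preserved : core {n} x' y' ≡ core {n} x y
  core-preserved = cong₂ (λ S D → (S ∪ tImg {n} S) ∪ D) product-preserved DS-y-preserved

  CS-preserved : CS {n} x' y' ≡ CS {n} x y
  CS-preserved = begin
    CS {n} x' y'             ≡⟨ CS≡core∪DS {n} x' y' ⟩
    core {n} x' y' ∪ DS {n} x'   ≡⟨ cong (_∪ DS {n} x') core-preserved ⟩
    core {n} x y ∪ DS {n} x'     ≡⟨ ∪-cong-outside (core {n} x y) (DS {n} x') (DS {n} x) same-DS-outside-core ⟩
    core {n} x y ∪ DS {n} x      ≡⟨ sym (CS≡core∪DS {n} x y) ⟩
    CS {n} x y               ∎
    where
    open ≡-Reasoning
    same-DS-outside-core : ∀ i → Free i → lookup (DS {n} x') i ≡ lookup (DS {n} x) i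
    same-DS-outside-core i h = trans (lookup-DS {n} x' i)
      (trans (broken-x' i) (trans (broken-x-π h) (sym (lookup-DS {n} x i))))

  -- a point outside CS(x , y) is free and intact, so π i = y i fixes it in x' and y'
  Supp₂⊆CS : Supp₂ {n} x' y' ⊆ CS {n} x y
  Supp₂⊆CS = ⊆-by-lookup fixed-outside
    where
    fixed-outside : ∀ i → lookup (CS {n} x y) i ≡ false → lookup (Supp₂ {n} x' y') i ≡ false
    fixed-outside i out = begin
      lookup (Supp₂ {n} x' y') i                   ≡⟨ lookup-∪ (Supp {n} x') (Supp {n} y') i ⟩
      lookup (Supp {n} x') i ∨ lookup (Supp {n} y') i  ≡⟨ cong₂ _∨_ (lookup-Supp {n} x' i) (lookup-Supp {n} y' i) ⟩
      moved x' i ∨ moved y' i                  ≡⟨ cong₂ _∨_ (≡⇒neq-false x'-fixes) (≡⇒neq-false y'-fixes) ⟩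
      false                                    ∎
      where
      open ≡-Reasoning
      outside-core∪DS : lookup (core {n} x y) i ∨ lookup (DS {n} x) i ≡ false
      outside-core∪DS = trans (sym (lookup-∪ (core {n} x y) (DS {n} x) i))
                              (trans (cong (λ A → lookup A i) (sym (CS≡core∪DS {n} x y))) out)
      free : Free i
      free = ∨-conicalˡ _ _ outside-core∪DS
      intact : broken {n} x i ≡ false
      intact = trans (sym (lookup-DS {n} x i)) (∨-conicalʳ _ _ outside-core∪DS)
      πi≡yi : π ⟨$⟩ʳ i ≡ y ⟨$⟩ʳ i
      πi≡yi = trans (π-agrees free) (f-intact intact)
      x'-fixes : x' ⟨$⟩ʳ i ≡ i
      x'-fixes = trans (cong (x ⟨$⟩ʳ_) πi≡yi) (xy-fixes free)
      y'-fixes : y' ⟨$⟩ʳ i ≡ i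
      y'-fixes = trans (cong (π ⟨$⟩ˡ_) (sym πi≡yi)) (inverseˡ π)

lemma4p3 : (n : ℕ) (x y : Perm (2 * n)) →
    Σ (Perm (2 * n)) λ a → Σ (Perm (2 * n)) λ b →
      InB n a × InB n b ×
      (Supp₂ {n} (actᵣ₁ a b x y) (actᵣ₂ a b x y) ⊆ CS {n} (actᵣ₁ a b x y) (actᵣ₂ a b x y)) ×
      (CS {n} (actᵣ₁ a b x y) (actᵣ₂ a b x y) ≡ CS {n} x y) ×
      (∣ Supp₂ {n} (actᵣ₁ a b x y) (actᵣ₂ a b x y) ∣ ≤ ∣ CS {n} x y ∣) ×
      (∣ CS {n} x y ∣ ≤ twoM {n} x y)
lemma4p3 n x y =
  id , flip π , (λ _ → refl) , inverse-B {n} {π} π-B ,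
  subst (Supp₂ {n} x' y' ⊆_) (sym CS-preserved) Supp₂⊆CS ,
  CS-preserved ,
  p⊆q⇒∣p∣≤∣q∣ Supp₂⊆CS ,
  ∣CS∣≤twoM {n} x y
  where open Construction {n} x y
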